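{- Let $F$ be a $k$-homogeneous $(n,m)$-function and let $U$ be a $k$-dimensional linear subspace of $\mathbb{F}_2^n$. Then $U\in N_k(F)$ if and only if $U^\perp\in N_{n-k}(\overline{F})$.
   Context: An $(n,m)$-function $F\colon\mathbb{F}_2^n\to\mathbb{F}_2^m$ has coordinate Boolean functions $f_1,\dots,f_m$, each in ANF as a sum of distinct monomials $x_I=\prod_{i\in I}x_i$. $F$ is $k$-homogeneous if all these monomials have degree $k$. The complement of $x_I$ is $x_{[n]\setminus I}$; the complement of $f=m_1+\dots+m_t$ is $\overline{f}=\overline{m_1}+\dots+\overline{m_t}$; $\overline{F}$ is the $(n,m)$-function with coordinates $\overline{f_1},\dots,\overline{f_m}$. For $j\in\{0,\dots,n\}$, $N_j(F)$ is the set of $j$-dimensional linear subspaces $V$ of $\mathbb{F}_2^n$ with $\sum_{x\in V}F(x)\neq0$. $U^\perp$ is the orthogonal complement of $U$ with respect to the standard dot product. -}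

module Defs where

open import Data.Nat using (ℕ; zero; suc)
open import Data.Bool using (Bool; true; false; _xor_; _∧_; not; if_then_else_)
open import Data.Vec using (Vec; []; _∷_; replicate; zipWith; map; foldr)
open import Data.List using (List; []; _∷_; _++_)
import Data.List as List
open import Data.List.Relation.Unary.All using (All)
open import Data.List.Relation.Unary.Unique.Propositional using (Unique)
open import Data.Fin.Subset using (Subset; ∁; ∣_∣)
open import Data.Product using (Σ; _×_)
open import Relation.Binary.PropositionalEquality using (_≡_; _≢_)
open import Function.Bundles using (_⇔_)

-- Vectors of F₂ⁿ (Bool = F₂, xor = addition, ∧ = multiplication)
F2^ : ℕ → Set
F2^ n = Vec Bool n

zeroV : ∀ {n} → F2^ n
zeroV = replicate _ false

_⊕_ : ∀ {n} → F2^ n → F2^ n → F2^ n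
_⊕_ = zipWith _xor_

dot : ∀ {n} → F2^ n → F2^ n → Bool
dot x y = foldr _ _xor_ false (zipWith _∧_ x y)

allVecs : (n : ℕ) → List (F2^ n)
allVecs zero = [] ∷ []
allVecs (suc n) = List.map (false ∷_) (allVecs n) ++ List.map (true ∷_) (allVecs n)

-- Monomials x_I, I ⊆ [n], represented by the subset I (Subset n = Vec Bool n)
Monomial : ℕ → Set
Monomial n = Subset n

evalMon : ∀ {n} → Monomial n → F2^ n → Bool
evalMon [] [] = true
evalMon (false ∷ I) (_ ∷ x) = evalMon I x
evalMon (true ∷ I) (b ∷ x) = b ∧ evalMon I x

-- A Boolean function in ANF: a sum of monomials (distinctness is IsANF below)
BoolFn : ℕ → Set
BoolFn n = List (Monomial n)

IsANF : ∀ {n} → BoolFn n → Set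
IsANF f = Unique f

evalFn : ∀ {n} → BoolFn n → F2^ n → Bool
evalFn f x = List.foldr (λ I acc → evalMon I x xor acc) false f

-- An (n,m)-function given by its m coordinate functions f₁,…,fₘ in ANF
VecFn : ℕ → ℕ → Set
VecFn n m = Vec (BoolFn n) m

IsANFVec : ∀ {n m} → VecFn n m → Set
IsANFVec F = Data.Vec.foldr _ (λ f acc → IsANF f × acc) (Data.Unit.⊤) F
  where import Data.Unit

evalVec : ∀ {n m} → VecFn n m → F2^ n → F2^ m
evalVec F x = map (λ f → evalFn f x) F

HomogeneousFn : ∀ {n} → ℕ → BoolFn n → Set
HomogeneousFn k f = All (λ I → ∣ I ∣ ≡ k) f

Homogeneous : ∀ {n m} → ℕ → VecFn n m → Set
Homogeneous k F = Data.Vec.foldr _ (λ f acc → HomogeneousFn k f × acc) (Data.Unit.⊤) F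
  where import Data.Unit

complMon : ∀ {n} → Monomial n → Monomial n
complMon = ∁

complFn : ∀ {n} → BoolFn n → BoolFn n
complFn = List.map complMon

complVec : ∀ {n m} → VecFn n m → VecFn n m
complVec = map complFn

VSet : ℕ → Set
VSet n = F2^ n → Bool

lincomb : ∀ {n j} → Vec Bool j → Vec (F2^ n) j → F2^ n
lincomb [] [] = zeroV
lincomb (c ∷ cs) (b ∷ bs) = (if c then b else zeroV) ⊕ lincomb cs bs

IsBasis : ∀ {n j} → VSet n → Vec (F2^ n) j → Set
IsBasis {n} {j} V b =
  ((c : Vec Bool j) → lincomb c b ≡ zeroV → c ≡ zeroV) ×
  ((x : F2^ n) → (V x ≡ true) ⇔ Σ (Vec Bool j) (λ c → lincomb c b ≡ x))

IsSubspaceDim : ∀ {n} → ℕ → VSet n → Set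
IsSubspaceDim {n} j V = Σ (Vec (F2^ n) j) (λ b → IsBasis V b)

sumOver : ∀ {n m} → VSet n → (F2^ n → F2^ m) → F2^ m
sumOver {n} V G =
  List.foldr (λ x acc → (if V x then G x else zeroV) ⊕ acc) zeroV (allVecs n)

allB : ∀ {A : Set} → (A → Bool) → List A → Bool
allB p [] = true
allB p (a ∷ as) = p a ∧ allB p as

perp : ∀ {n} → VSet n → VSet n
perp {n} U x = allB (λ y → if U y then not (dot x y) else true) (allVecs n)

InN : ∀ {n m} → ℕ → VecFn n m → VSet n → Set
InN j F V = IsSubspaceDim j V × (sumOver V (evalVec F) ≢ zeroV)

-- Every subspace U ⊆ F₂ⁿ has a presentation built coordinate by coordinate, in which each
-- coordinate is either a linear function of the following ones or a pivot, and exchanging the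
-- two kinds of coordinates presents U⊥.  If dim U = k, then over every coset of U the monomials
-- of degree < k sum to 0 and x_I with |I| = k sums to the Plücker coordinate p_I(U) (the minor
-- of a basis matrix on the columns I).  Expanding p_I(U) along the first coordinate gives a
-- recursion that the exchange turns into the recursion for p_∁I(U⊥), so the sum of x_I over U
-- equals the sum of x_∁I over U⊥; summing over the monomials of a k-homogeneous F gives the
-- equality of the sums of F over U and of F̄ over U⊥.

module Submission where

open import Defs
open import Algebra.Bundles using (CommutativeRing)
open import Algebra.Properties.CommutativeSemigroup using (interchange; x∙yz≈y∙xz)
open import Data.Bool using (Bool; true; false; _xor_; _∧_; _∨_; not; if_then_else_)
open import Data.Bool.Properties
  using ( xor-assoc; xor-comm; xor-identityʳ; xor-identityˡ; xor-same; xor-∧-commutativeRing; not-distribʳ-xor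
        ; ∧-assoc; ∧-comm; ∧-zeroʳ; ∧-identityʳ; ∧-distribˡ-xor; ∧-distribʳ-xor
        ; ∧-conicalˡ; ∧-conicalʳ
        ; ∨-identityʳ; not-involutive; not-injective; ¬-not; ⇔→≡ )
open import Data.Fin using (Fin; zero; suc)
open import Data.Fin.Subset using (Subset; ∁; ∣_∣)
open import Data.Fin.Subset.Properties using (∣∁p∣≡n∸∣p∣)
open import Data.List using (List; []; _∷_; _++_)
import Data.List as List
open import Data.List.Membership.Propositional using (_∈_)
open import Data.List.Membership.Propositional.Properties using (∈-map⁺; ∈-++⁺ˡ; ∈-++⁺ʳ)
open import Data.List.Relation.Unary.All as All using (All; []; _∷_)
open import Data.List.Relation.Unary.Any using (here)
open import Data.Nat using (ℕ; zero; suc; _+_; _∸_; _<_; s≤s)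
open import Data.Nat.Properties
  using (≤-refl; ≤-trans; n≤1+n; +-suc; m<1+n⇒m<n∨m≡n; suc-injective; m+n∸m≡n)
open import Data.Product using (Σ; _×_; _,_; proj₁; proj₂)
open import Data.Product.Function.NonDependent.Propositional using (_×-⇔_)
open import Data.Sum using (_⊎_; inj₁; inj₂; [_,_])
open import Data.Sum.Function.Propositional using (_⊎-⇔_)
open import Data.Vec using (Vec; []; _∷_; map; tabulate; lookup; _[_]%=_; _[_]≔_)
open import Data.Vec.Properties
  using ( zipWith-assoc; zipWith-comm; zipWith-identityˡ; zipWith-identityʳ; ∷-injectiveˡ; ∷-injectiveʳ
        ; tabulate-cong; tabulate∘lookup; lookup∘tabulate; lookup-replicate; lookup-map; map-[]≔; []≔-lookup
        ; map-const; map-cong )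
open import Function using (id; _∘_)
open import Function.Bundles using (_⇔_; mk⇔; module Equivalence)
open import Function.Construct.Composition using (_⇔-∘_)
open import Function.Construct.Identity using (⇔-id)
open import Function.Construct.Symmetry using (⇔-sym)
open import Relation.Nullary using (¬_)
open import Relation.Binary.PropositionalEquality
  using (_≡_; refl; sym; trans; cong; cong₂; subst; _≗_; module ≡-Reasoning)
open ≡-Reasoning

private variable
  n m k l : ℕ
  A B : Set

xor-interchange : ∀ a b c d → (a xor b) xor (c xor d) ≡ (a xor c) xor (b xor d)
xor-interchange = interchange (CommutativeRing.+-commutativeSemigroup xor-∧-commutativeRing)

∧-lcomm : ∀ a b c → a ∧ (b ∧ c) ≡ b ∧ (a ∧ c)
∧-lcomm = x∙yz≈y∙xz (CommutativeRing.*-commutativeSemigroup xor-∧-commutativeRing)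

xor-telescope : ∀ a b c → a xor c ≡ (a xor b) xor (b xor c)
xor-telescope a b c = begin
  a xor c                   ≡⟨ cong (λ t → a xor (t xor c)) (xor-same b) ⟨
  a xor ((b xor b) xor c)   ≡⟨ cong (a xor_) (xor-assoc b b c) ⟩
  a xor (b xor (b xor c))   ≡⟨ xor-assoc a b (b xor c) ⟨
  (a xor b) xor (b xor c)   ∎

⊕-assoc : (x y z : F2^ n) → (x ⊕ y) ⊕ z ≡ x ⊕ (y ⊕ z)
⊕-assoc = zipWith-assoc xor-assoc

⊕-comm : (x y : F2^ n) → x ⊕ y ≡ y ⊕ x
⊕-comm = zipWith-comm xor-comm

⊕-identityˡ : (x : F2^ n) → zeroV ⊕ x ≡ x
⊕-identityˡ = zipWith-identityˡ xor-identityˡ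

⊕-identityʳ : (x : F2^ n) → x ⊕ zeroV ≡ x
⊕-identityʳ = zipWith-identityʳ xor-identityʳ

⊕-self : (x : F2^ n) → x ⊕ x ≡ zeroV
⊕-self []      = refl
⊕-self (a ∷ x) = cong₂ _∷_ (xor-same a) (⊕-self x)

⊕-cancelʳ : (x y : F2^ n) → (x ⊕ y) ⊕ y ≡ x
⊕-cancelʳ x y = begin
  (x ⊕ y) ⊕ y   ≡⟨ ⊕-assoc x y y ⟩
  x ⊕ (y ⊕ y)   ≡⟨ cong (x ⊕_) (⊕-self y) ⟩
  x ⊕ zeroV     ≡⟨ ⊕-identityʳ x ⟩
  x             ∎

⊕-interchange : (w x y z : F2^ n) → (w ⊕ x) ⊕ (y ⊕ z) ≡ (w ⊕ y) ⊕ (x ⊕ z)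
⊕-interchange []      []      []      []      = refl
⊕-interchange (a ∷ w) (b ∷ x) (c ∷ y) (d ∷ z) =
  cong₂ _∷_ (xor-interchange a b c d) (⊕-interchange w x y z)

⊕-move : (b y x : F2^ n) → (b ⊕ y ≡ x) ⇔ (y ≡ x ⊕ b)
⊕-move b y x = mk⇔ to from
  where
  to : b ⊕ y ≡ x → y ≡ x ⊕ b
  to e = begin
    y             ≡⟨ ⊕-cancelʳ y b ⟨
    (y ⊕ b) ⊕ b   ≡⟨ cong (_⊕ b) (⊕-comm y b) ⟩
    (b ⊕ y) ⊕ b   ≡⟨ cong (_⊕ b) e ⟩
    x ⊕ b         ∎
  from : y ≡ x ⊕ b → b ⊕ y ≡ x
  from refl = trans (⊕-comm b (x ⊕ b)) (⊕-cancelʳ x b)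

⊕-flip : (y a : F2^ n) (j : Fin n) → y ⊕ (a [ j ]%= not) ≡ (y ⊕ a) [ j ]%= not
⊕-flip (b ∷ y) (c ∷ a) zero    = cong (_∷ (y ⊕ a)) (sym (not-distribʳ-xor b c))
⊕-flip (b ∷ y) (c ∷ a) (suc j) = cong ((b xor c) ∷_) (⊕-flip y a j)

dot-zeroʳ : (x : F2^ n) → dot x zeroV ≡ false
dot-zeroʳ []      = refl
dot-zeroʳ (a ∷ x) = trans (cong (_xor dot x zeroV) (∧-zeroʳ a)) (dot-zeroʳ x)

dot-zeroˡ : (x : F2^ n) → dot zeroV x ≡ false
dot-zeroˡ []      = refl
dot-zeroˡ (a ∷ x) = dot-zeroˡ x

dot-comm : (x y : F2^ n) → dot x y ≡ dot y x
dot-comm []      []      = refl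
dot-comm (a ∷ x) (b ∷ y) = cong₂ _xor_ (∧-comm a b) (dot-comm x y)

dot-distribˡ-⊕ : (x y z : F2^ n) → dot x (y ⊕ z) ≡ dot x y xor dot x z
dot-distribˡ-⊕ []      []      []      = refl
dot-distribˡ-⊕ (a ∷ x) (b ∷ y) (c ∷ z) = begin
  (a ∧ (b xor c)) xor dot x (y ⊕ z)
    ≡⟨ cong₂ _xor_ (∧-distribˡ-xor a b c) (dot-distribˡ-⊕ x y z) ⟩
  ((a ∧ b) xor (a ∧ c)) xor (dot x y xor dot x z)
    ≡⟨ xor-interchange (a ∧ b) (a ∧ c) (dot x y) (dot x z) ⟩
  ((a ∧ b) xor dot x y) xor ((a ∧ c) xor dot x z)   ∎

dot-distribʳ-⊕ : (x y z : F2^ n) → dot (y ⊕ z) x ≡ dot y x xor dot z x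
dot-distribʳ-⊕ x y z = begin
  dot (y ⊕ z) x           ≡⟨ dot-comm (y ⊕ z) x ⟩
  dot x (y ⊕ z)           ≡⟨ dot-distribˡ-⊕ x y z ⟩
  dot x y xor dot x z     ≡⟨ cong₂ _xor_ (dot-comm x y) (dot-comm x z) ⟩
  dot y x xor dot z x     ∎

dot-∧ʳ : (v w : F2^ n) (e : Bool) → dot v w ∧ e ≡ dot v (tabulate (λ j → lookup w j ∧ e))
dot-∧ʳ []      []      e = refl
dot-∧ʳ (a ∷ v) (b ∷ w) e = begin
  ((a ∧ b) xor dot v w) ∧ e          ≡⟨ ∧-distribʳ-xor e (a ∧ b) (dot v w) ⟩
  ((a ∧ b) ∧ e) xor (dot v w ∧ e)    ≡⟨ cong₂ _xor_ (∧-assoc a b e) (dot-∧ʳ v w e) ⟩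
  (a ∧ (b ∧ e)) xor dot v (tabulate (λ j → lookup w j ∧ e)) ∎

∑ⱽ : (F2^ n → Bool) → Bool
∑ⱽ {zero}  h = h []
∑ⱽ {suc n} h = ∑ⱽ (λ x → h (false ∷ x)) xor ∑ⱽ (λ x → h (true ∷ x))

∑ⱽ-cong : {g h : F2^ n → Bool} → g ≗ h → ∑ⱽ g ≡ ∑ⱽ h
∑ⱽ-cong {zero}  g≗h = g≗h []
∑ⱽ-cong {suc n} g≗h =
  cong₂ _xor_ (∑ⱽ-cong (λ x → g≗h (false ∷ x))) (∑ⱽ-cong (λ x → g≗h (true ∷ x)))

∑ⱽ-xor : (g h : F2^ n → Bool) → ∑ⱽ (λ x → g x xor h x) ≡ ∑ⱽ g xor ∑ⱽ h
∑ⱽ-xor {zero}  g h = refl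
∑ⱽ-xor {suc n} g h =
  trans (cong₂ _xor_ (∑ⱽ-xor (λ x → g (false ∷ x)) (λ x → h (false ∷ x)))
                     (∑ⱽ-xor (λ x → g (true ∷ x)) (λ x → h (true ∷ x))))
        (xor-interchange (∑ⱽ (λ x → g (false ∷ x))) _ _ _)

∑ⱽ-∧ˡ : (c : Bool) (h : F2^ n → Bool) → ∑ⱽ (λ x → c ∧ h x) ≡ c ∧ ∑ⱽ h
∑ⱽ-∧ˡ {zero}  c h = refl
∑ⱽ-∧ˡ {suc n} c h =
  trans (cong₂ _xor_ (∑ⱽ-∧ˡ c (λ x → h (false ∷ x))) (∑ⱽ-∧ˡ c (λ x → h (true ∷ x))))
        (sym (∧-distribˡ-xor c _ _))

∑ⱽ-translate : (h : F2^ n → Bool) (a : F2^ n) → ∑ⱽ (λ x → h (x ⊕ a)) ≡ ∑ⱽ h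
∑ⱽ-translate {zero}  h []          = refl
∑ⱽ-translate {suc n} h (false ∷ a) =
  cong₂ _xor_ (∑ⱽ-translate (λ x → h (false ∷ x)) a) (∑ⱽ-translate (λ x → h (true ∷ x)) a)
∑ⱽ-translate {suc n} h (true ∷ a)  =
  trans (cong₂ _xor_ (∑ⱽ-translate (λ x → h (true ∷ x)) a)
                     (∑ⱽ-translate (λ x → h (false ∷ x)) a))
        (xor-comm (∑ⱽ (λ x → h (true ∷ x))) _)

∑∈ : VSet n → (F2^ n → Bool) → Bool
∑∈ V g = ∑ⱽ (λ x → V x ∧ g x)

syntax ∑∈ V (λ x → g) = ∑[ x ∈ V ] g

∑∈-cong : (V : VSet n) {g h : F2^ n → Bool} → g ≗ h → ∑∈ V g ≡ ∑∈ V h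
∑∈-cong V g≗h = ∑ⱽ-cong (λ x → cong (V x ∧_) (g≗h x))

∑∈-cong-set : {V W : VSet n} (g : F2^ n → Bool) → V ≗ W → ∑∈ V g ≡ ∑∈ W g
∑∈-cong-set g V≗W = ∑ⱽ-cong (λ x → cong (_∧ g x) (V≗W x))

∑∈-xor : (V : VSet n) (g h : F2^ n → Bool) → ∑[ x ∈ V ] (g x xor h x) ≡ ∑∈ V g xor ∑∈ V h
∑∈-xor V g h =
  trans (∑ⱽ-cong (λ x → ∧-distribˡ-xor (V x) (g x) (h x))) (∑ⱽ-xor (λ x → V x ∧ g x) _)

∑∈-∧ˡ : (V : VSet n) (c : Bool) (g : F2^ n → Bool) → ∑[ x ∈ V ] (c ∧ g x) ≡ c ∧ ∑∈ V g
∑∈-∧ˡ V c g = trans (∑ⱽ-cong (λ x → ∧-lcomm (V x) c (g x))) (∑ⱽ-∧ˡ c (λ x → V x ∧ g x))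

∑∈-zero : (V : VSet n) → ∑[ x ∈ V ] false ≡ false
∑∈-zero V = ∑∈-∧ˡ V false (λ _ → false)

∑∈-dot : (V : VSet n) (v : F2^ m) (h : F2^ n → Fin m → Bool) →
  ∑[ y ∈ V ] dot v (tabulate (h y)) ≡ dot v (tabulate (λ j → ∑[ y ∈ V ] h y j))
∑∈-dot V []      h = ∑∈-zero V
∑∈-dot V (c ∷ v) h = begin
  ∑[ y ∈ V ] ((c ∧ h y zero) xor dot v (tabulate (λ j → h y (suc j))))   ≡⟨ ∑∈-xor V _ _ ⟩
  ∑[ y ∈ V ] (c ∧ h y zero) xor ∑[ y ∈ V ] dot v (tabulate (λ j → h y (suc j)))
    ≡⟨ cong₂ _xor_ (∑∈-∧ˡ V c (λ y → h y zero)) (∑∈-dot V v (λ y j → h y (suc j))) ⟩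
  (c ∧ ∑[ y ∈ V ] h y zero) xor dot v (tabulate (λ j → ∑[ y ∈ V ] h y (suc j))) ∎

evalMon-insert : (I : Monomial n) (j : Fin n) (w : F2^ n) →
  lookup w j ∧ evalMon I w ≡ evalMon (I [ j ]≔ true) w
evalMon-insert (false ∷ I) zero    (b ∷ w)     = refl
evalMon-insert (true ∷ I)  zero    (false ∷ w) = refl
evalMon-insert (true ∷ I)  zero    (true ∷ w)  = refl
evalMon-insert (false ∷ I) (suc j) (b ∷ w)     = evalMon-insert I j w
evalMon-insert (true ∷ I)  (suc j) (false ∷ w) = ∧-zeroʳ (lookup w j)
evalMon-insert (true ∷ I)  (suc j) (true ∷ w)  = evalMon-insert I j w

evalMon-flip : (J : Monomial n) (j : Fin n) (w : F2^ n) →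
  evalMon J w xor evalMon J (w [ j ]%= not) ≡ lookup J j ∧ evalMon (J [ j ]≔ false) w
evalMon-flip (false ∷ J) zero    (b ∷ w)     = xor-same (evalMon J w)
evalMon-flip (true ∷ J)  zero    (false ∷ w) = refl
evalMon-flip (true ∷ J)  zero    (true ∷ w)  = xor-identityʳ (evalMon J w)
evalMon-flip (false ∷ J) (suc j) (b ∷ w)     = evalMon-flip J j w
evalMon-flip (true ∷ J)  (suc j) (false ∷ w) = sym (∧-zeroʳ (lookup J j))
evalMon-flip (true ∷ J)  (suc j) (true ∷ w)  = evalMon-flip J j w

constant-derivatives⇒affine : (g : F2^ n → Bool) (c : F2^ n) →
  (∀ a j → g a xor g (a [ j ]%= not) ≡ lookup c j) →
  ∀ a v → g a xor g (v ⊕ a) ≡ dot v c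
constant-derivatives⇒affine g []       ∂g []       []      = xor-same (g [])
constant-derivatives⇒affine g (c ∷ cs) ∂g (a ∷ as) (b ∷ v) = begin
  g (a ∷ as) xor g ((b xor a) ∷ (v ⊕ as))
    ≡⟨ xor-telescope (g (a ∷ as)) (g ((b xor a) ∷ as)) _ ⟩
  (g (a ∷ as) xor g ((b xor a) ∷ as)) xor (g ((b xor a) ∷ as) xor g ((b xor a) ∷ (v ⊕ as)))
    ≡⟨ cong₂ _xor_ (first-coordinate b)
         (constant-derivatives⇒affine (λ x → g ((b xor a) ∷ x)) cs (λ x j → ∂g (_ ∷ x) (suc j)) as v) ⟩
  (b ∧ c) xor dot v cs ∎
  where
  first-coordinate : ∀ b → g (a ∷ as) xor g ((b xor a) ∷ as) ≡ b ∧ c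
  first-coordinate false = xor-same (g (a ∷ as))
  first-coordinate true  = ∂g (a ∷ as) zero

-- Presentations of subspaces

-- dep v S  = {(v·y, y) : y ∈ S}: the first coordinate is a linear function of the others;
-- free v S = {(0, y), (1, y + v) : y ∈ S}: the first coordinate is a pivot.
-- The indices are the ambient dimension, the dimension and the codimension.
data Presentation : ℕ → ℕ → ℕ → Set where
  []   : Presentation 0 0 0
  dep  : F2^ n → Presentation n k l → Presentation (suc n) k (suc l)
  free : F2^ n → Presentation n k l → Presentation (suc n) (suc k) l

shift : Bool → F2^ n → F2^ n → F2^ n
shift b v y = if b then y ⊕ v else y

⟦_⟧ : Presentation n k l → VSet n
⟦ [] ⟧       []      = true
⟦ dep v S ⟧  (b ∷ y) = not (b xor dot v y) ∧ ⟦ S ⟧ y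
⟦ free v S ⟧ (b ∷ y) = ⟦ S ⟧ (shift b v y)

dual : Presentation n k l → Presentation n l k
dual []         = []
dual (dep v S)  = free v (dual S)
dual (free v S) = dep v (dual S)

dimension-sum : Presentation n k l → k + l ≡ n
dimension-sum []                       = refl
dimension-sum (dep {k = k} {l = l} v S) = trans (+-suc k l) (cong suc (dimension-sum S))
dimension-sum (free v S)               = cong suc (dimension-sum S)

⟦⟧-zero : (R : Presentation n k l) → ⟦ R ⟧ zeroV ≡ true
⟦⟧-zero []         = refl
⟦⟧-zero (dep v S)  = trans (cong (λ d → not d ∧ ⟦ S ⟧ zeroV) (dot-zeroʳ v)) (⟦⟧-zero S)
⟦⟧-zero (free v S) = ⟦⟧-zero S

∈-dep : (v : F2^ n) (S : Presentation n k l) (b : Bool) (y : F2^ n) →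
  (⟦ dep v S ⟧ (b ∷ y) ≡ true) ⇔ (b ≡ dot v y × ⟦ S ⟧ y ≡ true)
∈-dep v S b y = lemma b (dot v y) (⟦ S ⟧ y)
  where
  lemma : ∀ b d s → (not (b xor d) ∧ s ≡ true) ⇔ (b ≡ d × s ≡ true)
  lemma false false s = mk⇔ (refl ,_) proj₂
  lemma true  true  s = mk⇔ (refl ,_) proj₂
  lemma false true  s = mk⇔ (λ ()) (λ ())
  lemma true  false s = mk⇔ (λ ()) (λ ())

dot-shift : (c : Bool) (v x y : F2^ n) → dot (shift c v x) y ≡ (c ∧ dot v y) xor dot x y
dot-shift false v x y = refl
dot-shift true  v x y = trans (dot-distribʳ-⊕ y x v) (xor-comm (dot x y) (dot v y))

-- Every subspace has a presentation

-- The presentations obtained by adding basis vectors one at a time: every dependent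
-- coordinate vanishes identically (null stands for dep zeroV), which makes them easy to extend.
data Echelon : ℕ → ℕ → Set where
  []    : Echelon 0 0
  null  : Echelon n k → Echelon (suc n) k
  pivot : F2^ n → Echelon n k → Echelon (suc n) (suc k)

⟦_⟧ₑ : Echelon n k → VSet n
⟦ [] ⟧ₑ        []      = true
⟦ null E ⟧ₑ    (b ∷ y) = not b ∧ ⟦ E ⟧ₑ y
⟦ pivot v E ⟧ₑ (b ∷ y) = ⟦ E ⟧ₑ (shift b v y)

toPresentation : Echelon n k → Σ ℕ (Presentation n k)
toPresentation []          = 0 , []
toPresentation (null E)    = suc (proj₁ (toPresentation E)) , dep zeroV (proj₂ (toPresentation E))
toPresentation (pivot v E) = proj₁ (toPresentation E) , free v (proj₂ (toPresentation E))

toPresentation-⟦⟧ : (E : Echelon n k) → ⟦ E ⟧ₑ ≗ ⟦ proj₂ (toPresentation E) ⟧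
toPresentation-⟦⟧ []          []      = refl
toPresentation-⟦⟧ (null E)    (b ∷ y) = cong₂ (λ d m → not d ∧ m) b≡ (toPresentation-⟦⟧ E y)
  where
  b≡ : b ≡ b xor dot zeroV y
  b≡ = sym (trans (cong (b xor_) (dot-zeroˡ y)) (xor-identityʳ b))
toPresentation-⟦⟧ (pivot v E) (b ∷ y) = toPresentation-⟦⟧ E (shift b v y)

shift-⊕ : (c b : Bool) (v x u : F2^ n) → shift c v x ⊕ shift b v u ≡ shift (c xor b) v (x ⊕ u)
shift-⊕ false false v x u = refl
shift-⊕ false true  v x u = sym (⊕-assoc x u v)
shift-⊕ true  false v x u = begin
  (x ⊕ v) ⊕ u   ≡⟨ ⊕-assoc x v u ⟩
  x ⊕ (v ⊕ u)   ≡⟨ cong (x ⊕_) (⊕-comm v u) ⟩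
  x ⊕ (u ⊕ v)   ≡⟨ ⊕-assoc x u v ⟨
  (x ⊕ u) ⊕ v   ∎
shift-⊕ true  true  v x u = begin
  (x ⊕ v) ⊕ (u ⊕ v)   ≡⟨ ⊕-interchange x v u v ⟩
  (x ⊕ u) ⊕ (v ⊕ v)   ≡⟨ cong ((x ⊕ u) ⊕_) (⊕-self v) ⟩
  (x ⊕ u) ⊕ zeroV     ≡⟨ ⊕-identityʳ (x ⊕ u) ⟩
  x ⊕ u               ∎

extend : (E : Echelon n k) (u : F2^ n) → ⟦ E ⟧ₑ u ≡ false → Echelon n (suc k)
extend []          []          ()
extend (null E)    (false ∷ u) u∉E = null (extend E u u∉E)
extend (null E)    (true ∷ u)  _   = pivot u E
extend (pivot v E) (b ∷ u)     u∉E = pivot v (extend E (shift b v u) u∉E)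

∈-extend : (E : Echelon n k) (u : F2^ n) (u∉E : ⟦ E ⟧ₑ u ≡ false) →
  ∀ x → ⟦ extend E u u∉E ⟧ₑ x ≡ ⟦ E ⟧ₑ x ∨ ⟦ E ⟧ₑ (x ⊕ u)
∈-extend []          []          ()
∈-extend (null E)    (false ∷ u) u∉E (false ∷ x) = ∈-extend E u u∉E x
∈-extend (null E)    (false ∷ u) u∉E (true ∷ x)  = refl
∈-extend (null E)    (true ∷ u)  u∉E (false ∷ x) = sym (∨-identityʳ (⟦ E ⟧ₑ x))
∈-extend (null E)    (true ∷ u)  u∉E (true ∷ x)  = refl
∈-extend (pivot v E) (b ∷ u)     u∉E (c ∷ x)     =
  trans (∈-extend E (shift b v u) u∉E (shift c v x))
        (cong (λ z → ⟦ E ⟧ₑ (shift c v x) ∨ ⟦ E ⟧ₑ z) (shift-⊕ c b v x u))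

InSpan : Vec (F2^ n) k → F2^ n → Set
InSpan {k = k} bs x = Σ (Vec Bool k) (λ c → lincomb c bs ≡ x)

-- IsBasis V bs unfolds to Independent bs × Spans V bs.
Independent : Vec (F2^ n) k → Set
Independent {k = k} bs = (c : Vec Bool k) → lincomb c bs ≡ zeroV → c ≡ zeroV

Spans : VSet n → Vec (F2^ n) k → Set
Spans {n} V bs = (x : F2^ n) → (V x ≡ true) ⇔ InSpan bs x

inSpan-∷ : (b : F2^ n) (bs : Vec (F2^ n) k) (x : F2^ n) →
  InSpan (b ∷ bs) x ⇔ (InSpan bs x ⊎ InSpan bs (x ⊕ b))
inSpan-∷ b bs x = mk⇔ to from
  where
  to : InSpan (b ∷ bs) x → InSpan bs x ⊎ InSpan bs (x ⊕ b)
  to (false ∷ c , e) = inj₁ (c , trans (sym (⊕-identityˡ _)) e)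
  to (true ∷ c , e)  = inj₂ (c , Equivalence.to (⊕-move b _ x) e)
  from : InSpan bs x ⊎ InSpan bs (x ⊕ b) → InSpan (b ∷ bs) x
  from (inj₁ (c , e)) = false ∷ c , trans (⊕-identityˡ _) e
  from (inj₂ (c , e)) = true ∷ c , Equivalence.from (⊕-move b _ x) e

≡true-resp : {a b : Bool} → a ≡ b → (a ≡ true) ⇔ (b ≡ true)
≡true-resp refl = ⇔-id _

∨-true⇔ : (a b : Bool) → (a ∨ b ≡ true) ⇔ (a ≡ true ⊎ b ≡ true)
∨-true⇔ true  b = mk⇔ (λ _ → inj₁ refl) (λ _ → refl)
∨-true⇔ false b = mk⇔ inj₂ [ (λ ()) , id ]

zeroSpace : (n : ℕ) → Echelon n 0
zeroSpace zero    = []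
zeroSpace (suc n) = null (zeroSpace n)

zeroSpace-spans : (n : ℕ) → Spans ⟦ zeroSpace n ⟧ₑ []
zeroSpace-spans n x = mk⇔ (λ x∈0 → [] , sym (to n x x∈0)) (λ { ([] , refl) → from n })
  where
  to : ∀ n (x : F2^ n) → ⟦ zeroSpace n ⟧ₑ x ≡ true → x ≡ zeroV
  to zero    []          _   = refl
  to (suc n) (false ∷ x) x∈0 = cong (false ∷_) (to n x x∈0)
  from : ∀ n → ⟦ zeroSpace n ⟧ₑ zeroV ≡ true
  from zero    = refl
  from (suc n) = from n

fromBasis : (bs : Vec (F2^ n) k) → Independent bs → Σ (Echelon n k) (λ E → Spans ⟦ E ⟧ₑ bs)
fromBasis {n} []       _   = zeroSpace n , zeroSpace-spans n
fromBasis     (b ∷ bs) ind = extend E b b∉E , spans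
  where
  ind-bs : Independent bs
  ind-bs c e = ∷-injectiveʳ (ind (false ∷ c) (trans (⊕-identityˡ _) e))
  E = proj₁ (fromBasis bs ind-bs)
  E-spans = proj₂ (fromBasis bs ind-bs)
  b∉span : ¬ InSpan bs b
  b∉span (c , e) with ind (true ∷ c) (trans (cong (b ⊕_) e) (⊕-self b))
  ... | ()
  b∉E : ⟦ E ⟧ₑ b ≡ false
  b∉E = ¬-not (b∉span ∘ Equivalence.to (E-spans b))
  spans : Spans ⟦ extend E b b∉E ⟧ₑ (b ∷ bs)
  spans x = ⇔-sym (inSpan-∷ b bs x)
        ⇔-∘ ((E-spans x ⊎-⇔ E-spans (x ⊕ b))
        ⇔-∘ (∨-true⇔ _ _
        ⇔-∘ ≡true-resp (∈-extend E b b∉E x)))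

presentation : (U : VSet n) → IsSubspaceDim k U →
  Σ ℕ (λ l → Σ (Presentation n k l) (λ R → U ≗ ⟦ R ⟧))
presentation U (b , independent , U-spans) with fromBasis b independent
... | E , E-spans = proj₁ (toPresentation E) , proj₂ (toPresentation E) ,
  λ x → trans (⇔→≡ (⇔-sym (E-spans x) ⇔-∘ U-spans x)) (toPresentation-⟦⟧ E x)

-- The dual presentation presents the orthogonal complement

basis : Presentation n k l → Vec (F2^ n) k
basis []         = []
basis (dep v S)  = map (λ w → dot v w ∷ w) (basis S)
basis (free v S) = (true ∷ v) ∷ map (false ∷_) (basis S)

lincomb-map : (f : F2^ n → F2^ m) → f zeroV ≡ zeroV → (∀ x y → f (x ⊕ y) ≡ f x ⊕ f y) →
  (c : Vec Bool k) (bs : Vec (F2^ n) k) → lincomb c (map f bs) ≡ f (lincomb c bs)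
lincomb-map f f0 f⊕ []          []       = sym f0
lincomb-map f f0 f⊕ (true ∷ c)  (b ∷ bs) =
  trans (cong (f b ⊕_) (lincomb-map f f0 f⊕ c bs)) (sym (f⊕ b _))
lincomb-map f f0 f⊕ (false ∷ c) (b ∷ bs) = begin
  zeroV ⊕ lincomb c (map f bs)   ≡⟨ ⊕-identityˡ _ ⟩
  lincomb c (map f bs)           ≡⟨ lincomb-map f f0 f⊕ c bs ⟩
  f (lincomb c bs)               ≡⟨ cong f (⊕-identityˡ _) ⟨
  f (zeroV ⊕ lincomb c bs)       ∎

lincomb-dep : (v : F2^ n) (c : Vec Bool k) (bs : Vec (F2^ n) k) →
  lincomb c (map (λ w → dot v w ∷ w) bs) ≡ dot v (lincomb c bs) ∷ lincomb c bs
lincomb-dep v = lincomb-map (λ w → dot v w ∷ w) (cong (_∷ zeroV) (dot-zeroʳ v))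
                            (λ x y → cong (_∷ (x ⊕ y)) (dot-distribˡ-⊕ v x y))

lincomb-free : (v : F2^ n) (c₀ : Bool) (c : Vec Bool k) (bs : Vec (F2^ n) k) →
  lincomb (c₀ ∷ c) ((true ∷ v) ∷ map (false ∷_) bs)
    ≡ c₀ ∷ ((if c₀ then v else zeroV) ⊕ lincomb c bs)
lincomb-free v c₀ c bs =
  trans (cong (_ ⊕_) (lincomb-map (false ∷_) refl (λ _ _ → refl) c bs)) (first-coordinate c₀)
  where
  first-coordinate : ∀ c₀ → (if c₀ then true ∷ v else zeroV) ⊕ (false ∷ lincomb c bs)
                            ≡ c₀ ∷ ((if c₀ then v else zeroV) ⊕ lincomb c bs)
  first-coordinate true  = refl
  first-coordinate false = refl

basis-independent : (R : Presentation n k l) → Independent (basis R)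
basis-independent []         []          _ = refl
basis-independent (dep v S)  c           e =
  basis-independent S c (∷-injectiveʳ (trans (sym (lincomb-dep v c (basis S))) e))
basis-independent (free v S) (true ∷ c)  e with ∷-injectiveˡ (trans (sym (lincomb-free v true c (basis S))) e)
... | ()
basis-independent (free v S) (false ∷ c) e = cong (false ∷_) (basis-independent S c
  (trans (sym (⊕-identityˡ _)) (∷-injectiveʳ (trans (sym (lincomb-free v false c (basis S))) e))))

unshift⇔ : (b : Bool) (v y x : F2^ n) → ((if b then v else zeroV) ⊕ y ≡ x) ⇔ (y ≡ shift b v x)
unshift⇔ false v y x = mk⇔ (trans (sym (⊕-identityˡ y))) (trans (⊕-identityˡ y))
unshift⇔ true  v y x = ⊕-move v y x

basis-spans : (R : Presentation n k l) → Spans ⟦ R ⟧ (basis R)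
basis-spans []         []      = mk⇔ (λ _ → [] , refl) (λ _ → refl)
basis-spans (dep v S)  (b ∷ x) = mk⇔ to from
  where
  to : ⟦ dep v S ⟧ (b ∷ x) ≡ true → InSpan (basis (dep v S)) (b ∷ x)
  to bx∈ with Equivalence.to (∈-dep v S b x) bx∈
  ... | b≡ , x∈S with Equivalence.to (basis-spans S x) x∈S
  ... | c , e = c , trans (lincomb-dep v c (basis S)) (cong₂ _∷_ (trans (cong (dot v) e) (sym b≡)) e)
  from : InSpan (basis (dep v S)) (b ∷ x) → ⟦ dep v S ⟧ (b ∷ x) ≡ true
  from (c , e) = Equivalence.from (∈-dep v S b x)
    ( trans (sym (∷-injectiveˡ e′)) (cong (dot v) (∷-injectiveʳ e′))
    , Equivalence.from (basis-spans S x) (c , ∷-injectiveʳ e′) )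
    where
    e′ = trans (sym (lincomb-dep v c (basis S))) e
basis-spans (free v S) (b ∷ x) = mk⇔ to from
  where
  to : ⟦ S ⟧ (shift b v x) ≡ true → InSpan (basis (free v S)) (b ∷ x)
  to y∈S with Equivalence.to (basis-spans S (shift b v x)) y∈S
  ... | c , e =
    b ∷ c , trans (lincomb-free v b c (basis S)) (cong (b ∷_) (Equivalence.from (unshift⇔ b v _ x) e))
  from : InSpan (basis (free v S)) (b ∷ x) → ⟦ S ⟧ (shift b v x) ≡ true
  from (c₀ ∷ c , e) = subst (λ b′ → ⟦ S ⟧ (shift b′ v x) ≡ true) (∷-injectiveˡ e′)
    (Equivalence.from (basis-spans S (shift c₀ v x))
                      (c , Equivalence.to (unshift⇔ c₀ v _ x) (∷-injectiveʳ e′)))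
    where
    e′ = trans (sym (lincomb-free v c₀ c (basis S))) e

Orthogonal : VSet n → F2^ n → Set
Orthogonal V x = ∀ y → V y ≡ true → dot x y ≡ false

allB-true⇔All : (p : A → Bool) (xs : List A) → (allB p xs ≡ true) ⇔ All (λ y → p y ≡ true) xs
allB-true⇔All p []       = mk⇔ (λ _ → []) (λ _ → refl)
allB-true⇔All p (x ∷ xs) = mk⇔
  (λ e → ∧-conicalˡ _ _ e ∷ Equivalence.to (allB-true⇔All p xs) (∧-conicalʳ _ _ e))
  (λ { (px ∷ pxs) → cong₂ _∧_ px (Equivalence.from (allB-true⇔All p xs) pxs) })

∈-allVecs : (x : F2^ n) → x ∈ allVecs n
∈-allVecs []          = here refl
∈-allVecs (false ∷ x) = ∈-++⁺ˡ (∈-map⁺ (false ∷_) (∈-allVecs x))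
∈-allVecs (true ∷ x)  = ∈-++⁺ʳ _ (∈-map⁺ (true ∷_) (∈-allVecs x))

perp⇔orthogonal : (V : VSet n) (x : F2^ n) → (perp V x ≡ true) ⇔ Orthogonal V x
perp⇔orthogonal {n} V x = mk⇔
  (λ e y → Equivalence.to (orthogonal-at y) (All.lookup (Equivalence.to all⇔ e) (∈-allVecs y)))
  (λ o → Equivalence.from all⇔ (All.tabulate (λ {y} _ → Equivalence.from (orthogonal-at y) (o y))))
  where
  all⇔ = allB-true⇔All (λ y → if V y then not (dot x y) else true) (allVecs n)
  orthogonal-at : ∀ y → ((if V y then not (dot x y) else true) ≡ true) ⇔ (V y ≡ true → dot x y ≡ false)
  orthogonal-at y with V y
  ... | true  = mk⇔ (λ e _ → not-injective e) (λ o → cong not (o refl))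
  ... | false = mk⇔ (λ _ ()) (λ _ → refl)

orthogonal-dep : (v : F2^ n) (S : Presentation n k l) (c : Bool) (x : F2^ n) →
  Orthogonal ⟦ dep v S ⟧ (c ∷ x) ⇔ Orthogonal ⟦ S ⟧ (shift c v x)
orthogonal-dep v S c x = mk⇔
  (λ o y y∈S → trans (dot-shift c v x y)
                      (o (dot v y ∷ y) (Equivalence.from (∈-dep v S _ y) (refl , y∈S))))
  (λ o → λ { (b ∷ y) by∈R → from o b y (Equivalence.to (∈-dep v S b y) by∈R) })
  where
  from : Orthogonal ⟦ S ⟧ (shift c v x) →
         ∀ b y → b ≡ dot v y × ⟦ S ⟧ y ≡ true → (c ∧ b) xor dot x y ≡ false
  from o b y (refl , y∈S) = trans (sym (dot-shift c v x y)) (o y y∈S)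

orthogonal-free : (v : F2^ n) (S : Presentation n k l) (c : Bool) (x : F2^ n) →
  Orthogonal ⟦ free v S ⟧ (c ∷ x) ⇔ (c ≡ dot v x × Orthogonal ⟦ S ⟧ x)
orthogonal-free v S c x = mk⇔ to from
  where
  to : Orthogonal ⟦ free v S ⟧ (c ∷ x) → c ≡ dot v x × Orthogonal ⟦ S ⟧ x
  to o = c≡ , λ y y∈S → trans (cong (_xor dot x y) (sym (∧-zeroʳ c))) (o (false ∷ y) y∈S)
    where
    pivot∈ : ⟦ free v S ⟧ (true ∷ v) ≡ true
    pivot∈ = trans (cong ⟦ S ⟧ (⊕-self v)) (⟦⟧-zero S)
    xor-false⇒≡ : ∀ a b → a xor b ≡ false → a ≡ b
    xor-false⇒≡ false false _ = refl
    xor-false⇒≡ true  true  _ = refl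
    c≡ : c ≡ dot v x
    c≡ = trans (xor-false⇒≡ c (dot x v)
                  (trans (cong (_xor dot x v) (sym (∧-identityʳ c))) (o (true ∷ v) pivot∈)))
               (dot-comm x v)
  from : c ≡ dot v x × Orthogonal ⟦ S ⟧ x → Orthogonal ⟦ free v S ⟧ (c ∷ x)
  from (refl , o) (b ∷ y) y∈ = begin
    (dot v x ∧ b) xor dot x y                ≡⟨ cong₂ _xor_ (∧-comm (dot v x) b) (dot-comm x y) ⟩
    (b ∧ dot v x) xor dot y x                ≡⟨ dot-shift b v y x ⟨
    dot (shift b v y) x                      ≡⟨ dot-comm (shift b v y) x ⟩
    dot x (shift b v y)                      ≡⟨ o (shift b v y) y∈ ⟩
    false                                    ∎

dual⇔orthogonal : (R : Presentation n k l) (x : F2^ n) → (⟦ dual R ⟧ x ≡ true) ⇔ Orthogonal ⟦ R ⟧ x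
dual⇔orthogonal []         []      = mk⇔ (λ { _ [] _ → refl }) (λ _ → refl)
dual⇔orthogonal (dep v S)  (c ∷ x) = ⇔-sym (orthogonal-dep v S c x) ⇔-∘ dual⇔orthogonal S (shift c v x)
dual⇔orthogonal (free v S) (c ∷ x) =
  ⇔-sym (orthogonal-free v S c x) ⇔-∘ ((⇔-id _ ×-⇔ dual⇔orthogonal S x) ⇔-∘ ∈-dep v (dual S) c x)

perp-dual : (U : VSet n) (R : Presentation n k l) → U ≗ ⟦ R ⟧ → perp U ≗ ⟦ dual R ⟧
perp-dual U R U≗R x =
  ⇔→≡ (⇔-sym (dual⇔orthogonal R x) ⇔-∘ (orthogonal-resp ⇔-∘ perp⇔orthogonal U x))
  where
  orthogonal-resp : Orthogonal U x ⇔ Orthogonal ⟦ R ⟧ x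
  orthogonal-resp = mk⇔ (λ o y y∈R → o y (trans (U≗R y) y∈R))
                        (λ o y y∈U → o y (trans (sym (U≗R y)) y∈U))

perp-subspaceDim : (U : VSet n) (R : Presentation n k l) → U ≗ ⟦ R ⟧ → IsSubspaceDim l (perp U)
perp-subspaceDim U R U≗R = basis (dual R) , basis-independent (dual R) ,
  λ x → basis-spans (dual R) x ⇔-∘ ≡true-resp (perp-dual U R U≗R x)

-- Monomial sums and Plücker coordinates

∑∈-dep : (v : F2^ n) (S : Presentation n k l) (g : F2^ (suc n) → Bool) →
  ∑∈ ⟦ dep v S ⟧ g ≡ ∑[ y ∈ ⟦ S ⟧ ] g (dot v y ∷ y)
∑∈-dep v S g =
  trans (sym (∑ⱽ-xor (λ y → (not (dot v y) ∧ ⟦ S ⟧ y) ∧ g (false ∷ y)) _))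
        (∑ⱽ-cong (λ y → select (dot v y) (⟦ S ⟧ y) (λ b → g (b ∷ y))))
  where
  select : ∀ d s (G : Bool → Bool) →
           ((not d ∧ s) ∧ G false) xor ((not (not d) ∧ s) ∧ G true) ≡ s ∧ G d
  select false s G = xor-identityʳ (s ∧ G false)
  select true  s G = refl

∑∈-free : (v : F2^ n) (S : Presentation n k l) (g : F2^ (suc n) → Bool) →
  ∑∈ ⟦ free v S ⟧ g
    ≡ ∑[ y ∈ ⟦ S ⟧ ] g (false ∷ y) xor ∑[ y ∈ ⟦ S ⟧ ] g (true ∷ (y ⊕ v))
∑∈-free v S g = cong (∑[ y ∈ ⟦ S ⟧ ] g (false ∷ y) xor_) (begin
  ∑ⱽ (λ y → ⟦ S ⟧ (y ⊕ v) ∧ g (true ∷ y))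
    ≡⟨ ∑ⱽ-translate (λ y → ⟦ S ⟧ (y ⊕ v) ∧ g (true ∷ y)) v ⟨
  ∑ⱽ (λ y → ⟦ S ⟧ ((y ⊕ v) ⊕ v) ∧ g (true ∷ (y ⊕ v)))
    ≡⟨ ∑ⱽ-cong (λ y → cong (λ z → ⟦ S ⟧ z ∧ g (true ∷ (y ⊕ v))) (⊕-cancelʳ y v)) ⟩
  ∑[ y ∈ ⟦ S ⟧ ] g (true ∷ (y ⊕ v))                        ∎)

cosetSum : Presentation n k l → F2^ n → Monomial n → Bool
cosetSum R a I = ∑[ x ∈ ⟦ R ⟧ ] evalMon I (x ⊕ a)

cosetSum-dep-false : (v : F2^ n) (S : Presentation n k l) (c : Bool) (a : F2^ n) (I : Monomial n) →
  cosetSum (dep v S) (c ∷ a) (false ∷ I) ≡ cosetSum S a I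
cosetSum-dep-false v S c a I = ∑∈-dep v S (λ x → evalMon (false ∷ I) (x ⊕ (c ∷ a)))

cosetSum-dep-true : (v : F2^ n) (S : Presentation n k l) (c : Bool) (a : F2^ n) (I : Monomial n) →
  cosetSum (dep v S) (c ∷ a) (true ∷ I)
    ≡ dot v (tabulate (λ j → cosetSum S a (I [ j ]≔ true))) xor ((dot v a xor c) ∧ cosetSum S a I)
cosetSum-dep-true {n} v S c a I = begin
  cosetSum (dep v S) (c ∷ a) (true ∷ I)
    ≡⟨ ∑∈-dep v S (λ x → evalMon (true ∷ I) (x ⊕ (c ∷ a))) ⟩
  ∑[ y ∈ ⟦ S ⟧ ] ((dot v y xor c) ∧ xᴵ y)
    ≡⟨ ∑∈-cong ⟦ S ⟧ expand ⟩
  ∑[ y ∈ ⟦ S ⟧ ] (dot v (xᴵ⁺ y) xor (d ∧ xᴵ y))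
    ≡⟨ ∑∈-xor ⟦ S ⟧ (λ y → dot v (xᴵ⁺ y)) (λ y → d ∧ xᴵ y) ⟩
  ∑[ y ∈ ⟦ S ⟧ ] dot v (xᴵ⁺ y) xor ∑[ y ∈ ⟦ S ⟧ ] (d ∧ xᴵ y)
    ≡⟨ cong₂ _xor_ (∑∈-dot ⟦ S ⟧ v (λ y j → evalMon (I [ j ]≔ true) (y ⊕ a)))
                   (∑∈-∧ˡ ⟦ S ⟧ d xᴵ) ⟩
  dot v (tabulate (λ j → cosetSum S a (I [ j ]≔ true))) xor (d ∧ cosetSum S a I) ∎
  where
  d = dot v a xor c
  xᴵ : F2^ n → Bool
  xᴵ y = evalMon I (y ⊕ a)
  xᴵ⁺ : F2^ n → F2^ n
  xᴵ⁺ y = tabulate (λ j → evalMon (I [ j ]≔ true) (y ⊕ a))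
  expand : ∀ y → (dot v y xor c) ∧ xᴵ y ≡ dot v (xᴵ⁺ y) xor (d ∧ xᴵ y)
  expand y = begin
    (dot v y xor c) ∧ xᴵ y                ≡⟨ cong (λ z → (dot v z xor c) ∧ xᴵ y) (⊕-cancelʳ y a) ⟨
    (dot v (w ⊕ a) xor c) ∧ xᴵ y          ≡⟨ cong (λ z → (z xor c) ∧ xᴵ y) (dot-distribˡ-⊕ v w a) ⟩
    ((dot v w xor dot v a) xor c) ∧ xᴵ y  ≡⟨ cong (_∧ xᴵ y) (xor-assoc (dot v w) (dot v a) c) ⟩
    (dot v w xor d) ∧ xᴵ y                ≡⟨ ∧-distribʳ-xor (xᴵ y) (dot v w) d ⟩
    (dot v w ∧ xᴵ y) xor (d ∧ xᴵ y)       ≡⟨ cong (_xor (d ∧ xᴵ y)) (dot-∧ʳ v w (xᴵ y)) ⟩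
    dot v (tabulate (λ j → lookup w j ∧ xᴵ y)) xor (d ∧ xᴵ y)
      ≡⟨ cong (λ t → dot v t xor (d ∧ xᴵ y)) (tabulate-cong (λ j → evalMon-insert I j w)) ⟩
    dot v (xᴵ⁺ y) xor (d ∧ xᴵ y)          ∎
    where
    w = y ⊕ a

cosetSum-free-true : (v : F2^ n) (S : Presentation n k l) (c : Bool) (a : F2^ n) (I : Monomial n) →
  cosetSum (free v S) (c ∷ a) (true ∷ I) ≡ cosetSum S (if c then a else v ⊕ a) I
cosetSum-free-true v S c a I = trans (∑∈-free v S (λ x → evalMon (true ∷ I) (x ⊕ (c ∷ a)))) (select c)
  where
  select : ∀ c → ∑[ y ∈ ⟦ S ⟧ ] (c ∧ evalMon I (y ⊕ a))
                   xor ∑[ y ∈ ⟦ S ⟧ ] (not c ∧ evalMon I ((y ⊕ v) ⊕ a))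
                 ≡ cosetSum S (if c then a else v ⊕ a) I
  select true  = trans (cong (cosetSum S a I xor_) (∑∈-zero ⟦ S ⟧)) (xor-identityʳ _)
  select false = trans (cong (_xor ∑[ y ∈ ⟦ S ⟧ ] evalMon I ((y ⊕ v) ⊕ a)) (∑∈-zero ⟦ S ⟧))
                       (∑∈-cong ⟦ S ⟧ (λ y → cong (evalMon I) (⊕-assoc y v a)))

cosetSum-free-false : (v : F2^ n) (S : Presentation n k l) (c : Bool) (a : F2^ n) (I : Monomial n) →
  cosetSum (free v S) (c ∷ a) (false ∷ I) ≡ cosetSum S a I xor cosetSum S (v ⊕ a) I
cosetSum-free-false v S c a I =
  trans (∑∈-free v S (λ x → evalMon (false ∷ I) (x ⊕ (c ∷ a))))
        (cong (cosetSum S a I xor_) (∑∈-cong ⟦ S ⟧ (λ y → cong (evalMon I) (⊕-assoc y v a))))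

cosetSum-flip : (S : Presentation n k l) (a : F2^ n) (J : Monomial n) (j : Fin n) →
  cosetSum S a J xor cosetSum S (a [ j ]%= not) J ≡ lookup J j ∧ cosetSum S a (J [ j ]≔ false)
cosetSum-flip S a J j = begin
  cosetSum S a J xor cosetSum S (a [ j ]%= not) J
    ≡⟨ ∑∈-xor ⟦ S ⟧ _ _ ⟨
  ∑[ y ∈ ⟦ S ⟧ ] (evalMon J (y ⊕ a) xor evalMon J (y ⊕ (a [ j ]%= not)))
    ≡⟨ ∑∈-cong ⟦ S ⟧ (λ y → trans (cong (λ z → evalMon J (y ⊕ a) xor evalMon J z) (⊕-flip y a j))
                                  (evalMon-flip J j (y ⊕ a))) ⟩
  ∑[ y ∈ ⟦ S ⟧ ] (lookup J j ∧ evalMon (J [ j ]≔ false) (y ⊕ a))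
    ≡⟨ ∑∈-∧ˡ ⟦ S ⟧ (lookup J j) _ ⟩
  lookup J j ∧ cosetSum S a (J [ j ]≔ false)
    ∎

∣insert∣ : (I : Subset n) (j : Fin n) → lookup I j ≡ false → ∣ I [ j ]≔ true ∣ ≡ suc ∣ I ∣
∣insert∣ (false ∷ I) zero    _ = refl
∣insert∣ (false ∷ I) (suc j) e = ∣insert∣ I j e
∣insert∣ (true ∷ I)  (suc j) e = cong suc (∣insert∣ I j e)

∣remove∣ : (J : Subset n) (j : Fin n) → lookup J j ≡ true → suc ∣ J [ j ]≔ false ∣ ≡ ∣ J ∣
∣remove∣ (true ∷ J)  zero    _ = refl
∣remove∣ (false ∷ J) (suc j) e = ∣remove∣ J j e
∣remove∣ (true ∷ J)  (suc j) e = cong suc (∣remove∣ J j e)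

insert-member : (I : Subset n) (j : Fin n) → lookup I j ≡ true → I [ j ]≔ true ≡ I
insert-member I j e = trans (cong (I [ j ]≔_) (sym e)) ([]≔-lookup I j)

-- The Plücker coordinate of ⟦ R ⟧ at I (the minor of a basis matrix on the columns I),
-- expanded along the first coordinate; it is only meaningful when ∣ I ∣ = k.
plücker : Presentation n k l → Monomial n → Bool
plücker []         []          = true
plücker (dep v S)  (false ∷ I) = plücker S I
plücker (dep v S)  (true ∷ I)  = dot v (tabulate (λ j → not (lookup I j) ∧ plücker S (I [ j ]≔ true)))
plücker (free v S) (true ∷ I)  = plücker S I
plücker (free v S) (false ∷ I) = dot v (tabulate (λ j → lookup I j ∧ plücker S (I [ j ]≔ false)))

plücker-dual : (R : Presentation n k l) (I : Monomial n) → plücker R I ≡ plücker (dual R) (∁ I)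
plücker-dual []         []          = refl
plücker-dual (dep v S)  (false ∷ I) = plücker-dual S I
plücker-dual (dep v S)  (true ∷ I)  = cong (dot v) (tabulate-cong λ j →
  cong₂ _∧_ (sym (lookup-map j not I))
            (trans (plücker-dual S (I [ j ]≔ true)) (cong (plücker (dual S)) (map-[]≔ not I j))))
plücker-dual (free v S) (true ∷ I)  = plücker-dual S I
plücker-dual (free v S) (false ∷ I) = cong (dot v) (tabulate-cong λ j →
  cong₂ _∧_ (trans (sym (not-involutive (lookup I j))) (cong not (sym (lookup-map j not I))))
            (trans (plücker-dual S (I [ j ]≔ false)) (cong (plücker (dual S)) (map-[]≔ not I j))))

Vanishes : Presentation n k l → Set
Vanishes {n} {k} R = (a : F2^ n) (I : Monomial n) → ∣ I ∣ < k → cosetSum R a I ≡ false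

IsPlücker : Presentation n k l → Set
IsPlücker {n} {k} R = (a : F2^ n) (I : Monomial n) → ∣ I ∣ ≡ k → cosetSum R a I ≡ plücker R I

dot-tabulate-false : (v : F2^ n) (h : Fin n → Bool) → (∀ j → h j ≡ false) → dot v (tabulate h) ≡ false
dot-tabulate-false v h h≡false = begin
  dot v (tabulate h)
    ≡⟨ cong (dot v) (tabulate-cong (λ j → trans (h≡false j) (sym (lookup-replicate j false)))) ⟩
  dot v (tabulate (lookup zeroV))  ≡⟨ cong (dot v) (tabulate∘lookup zeroV) ⟩
  dot v zeroV                      ≡⟨ dot-zeroʳ v ⟩
  false                            ∎

dep-vanishes : (v : F2^ n) (S : Presentation n k l) → Vanishes S → Vanishes (dep v S)
dep-vanishes v S low (c ∷ a) (false ∷ I) lt = trans (cosetSum-dep-false v S c a I) (low a I lt)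
dep-vanishes v S low (c ∷ a) (true ∷ I)  lt = begin
  cosetSum (dep v S) (c ∷ a) (true ∷ I)                    ≡⟨ cosetSum-dep-true v S c a I ⟩
  dot v (tabulate (λ j → cosetSum S a (I [ j ]≔ true))) xor ((dot v a xor c) ∧ cosetSum S a I)
    ≡⟨ cong₂ _xor_ (dot-tabulate-false v _ insert-vanishes) (cong ((dot v a xor c) ∧_) (low a I ∣I∣<k)) ⟩
  false xor ((dot v a xor c) ∧ false)                      ≡⟨ ∧-zeroʳ (dot v a xor c) ⟩
  false                                                    ∎
  where
  ∣I∣<k = ≤-trans (n≤1+n _) lt
  insert-vanishes : ∀ j → cosetSum S a (I [ j ]≔ true) ≡ false
  insert-vanishes j with lookup I j in e
  ... | true  = trans (cong (cosetSum S a) (insert-member I j e)) (low a I ∣I∣<k)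
  ... | false = low a (I [ j ]≔ true) (subst (_< _) (sym (∣insert∣ I j e)) lt)

dep-plücker : (v : F2^ n) (S : Presentation n k l) → Vanishes S → IsPlücker S → IsPlücker (dep v S)
dep-plücker v S low top (c ∷ a) (false ∷ I) eq = trans (cosetSum-dep-false v S c a I) (top a I eq)
dep-plücker v S low top (c ∷ a) (true ∷ I)  eq = begin
  cosetSum (dep v S) (c ∷ a) (true ∷ I)                    ≡⟨ cosetSum-dep-true v S c a I ⟩
  dot v (tabulate (λ j → cosetSum S a (I [ j ]≔ true))) xor ((dot v a xor c) ∧ cosetSum S a I)
    ≡⟨ cong₂ _xor_ (cong (dot v) (tabulate-cong insert-term)) (cong ((dot v a xor c) ∧_) (low a I ∣I∣<k)) ⟩
  plücker (dep v S) (true ∷ I) xor ((dot v a xor c) ∧ false)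
    ≡⟨ cong (plücker (dep v S) (true ∷ I) xor_) (∧-zeroʳ (dot v a xor c)) ⟩
  plücker (dep v S) (true ∷ I) xor false                   ≡⟨ xor-identityʳ _ ⟩
  plücker (dep v S) (true ∷ I)                             ∎
  where
  ∣I∣<k = subst (∣ I ∣ <_) eq ≤-refl
  insert-term : ∀ j → cosetSum S a (I [ j ]≔ true) ≡ not (lookup I j) ∧ plücker S (I [ j ]≔ true)
  insert-term j with lookup I j in e
  ... | true  = trans (cong (cosetSum S a) (insert-member I j e)) (low a I ∣I∣<k)
  ... | false = top a (I [ j ]≔ true) (trans (∣insert∣ I j e) eq)

free-vanishes : (v : F2^ n) (S : Presentation n k l) → Vanishes S → IsPlücker S → Vanishes (free v S)
free-vanishes v S low top (c ∷ a) (true ∷ I)  (s≤s lt) =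
  trans (cosetSum-free-true v S c a I) (low _ I lt)
free-vanishes v S low top (c ∷ a) (false ∷ I) lt with m<1+n⇒m<n∨m≡n lt
... | inj₁ lt′ = trans (cosetSum-free-false v S c a I) (cong₂ _xor_ (low a I lt′) (low (v ⊕ a) I lt′))
... | inj₂ eq  = trans (cosetSum-free-false v S c a I)
                       (trans (cong₂ _xor_ (top a I eq) (top (v ⊕ a) I eq)) (xor-same (plücker S I)))

free-plücker : (v : F2^ n) (S : Presentation n k l) → IsPlücker S → IsPlücker (free v S)
free-plücker v S top (c ∷ a) (true ∷ I)  eq =
  trans (cosetSum-free-true v S c a I) (top _ I (suc-injective eq))
-- By the top-degree case for S, b ↦ cosetSum S b I has constant partial derivatives, hence is affine.
free-plücker v S top (c ∷ a) (false ∷ I) eq = trans (cosetSum-free-false v S c a I)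
  (constant-derivatives⇒affine (λ b → cosetSum S b I) _ derivative a v)
  where
  remove-term : ∀ b j → lookup I j ∧ cosetSum S b (I [ j ]≔ false)
                        ≡ lookup I j ∧ plücker S (I [ j ]≔ false)
  remove-term b j with lookup I j in e
  ... | false = refl
  ... | true  = top b (I [ j ]≔ false) (suc-injective (trans (∣remove∣ I j e) eq))
  derivative : ∀ b j → cosetSum S b I xor cosetSum S (b [ j ]%= not) I
                       ≡ lookup (tabulate (λ j → lookup I j ∧ plücker S (I [ j ]≔ false))) j
  derivative b j = trans (cosetSum-flip S b I j) (trans (remove-term b j) (sym (lookup∘tabulate _ j)))

cosetSums : (R : Presentation n k l) → Vanishes R × IsPlücker R
cosetSums []         = (λ { [] [] () }) , (λ { [] [] _ → refl })
cosetSums (dep v S)  with cosetSums S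
... | low , top = dep-vanishes v S low , dep-plücker v S low top
cosetSums (free v S) with cosetSums S
... | low , top = free-vanishes v S low top , free-plücker v S top

monomialSum-dual : (R : Presentation n k l) (I : Monomial n) → ∣ I ∣ ≡ k →
  ∑∈ ⟦ R ⟧ (evalMon I) ≡ ∑∈ ⟦ dual R ⟧ (evalMon (∁ I))
monomialSum-dual {n} {k} {l} R I eq = begin
  ∑∈ ⟦ R ⟧ (evalMon I)                 ≡⟨ at-zero R I ⟨
  cosetSum R zeroV I                   ≡⟨ proj₂ (cosetSums R) zeroV I eq ⟩
  plücker R I                          ≡⟨ plücker-dual R I ⟩
  plücker (dual R) (∁ I)               ≡⟨ proj₂ (cosetSums (dual R)) zeroV (∁ I) ∣∁I∣≡l ⟨
  cosetSum (dual R) zeroV (∁ I)        ≡⟨ at-zero (dual R) (∁ I) ⟩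
  ∑∈ ⟦ dual R ⟧ (evalMon (∁ I))        ∎
  where
  at-zero : ∀ {k l} (R : Presentation n k l) J → cosetSum R zeroV J ≡ ∑∈ ⟦ R ⟧ (evalMon J)
  at-zero R J = ∑∈-cong ⟦ R ⟧ (λ x → cong (evalMon J) (⊕-identityʳ x))
  ∣∁I∣≡l : ∣ ∁ I ∣ ≡ l
  ∣∁I∣≡l = begin
    ∣ ∁ I ∣      ≡⟨ ∣∁p∣≡n∸∣p∣ I ⟩
    n ∸ ∣ I ∣    ≡⟨ cong₂ _∸_ (sym (dimension-sum R)) eq ⟩
    k + l ∸ k    ≡⟨ m+n∸m≡n k l ⟩
    l            ∎

xorSum : (A → Bool) → List A → Bool
xorSum h []       = false
xorSum h (x ∷ xs) = h x xor xorSum h xs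

xorSum-++ : (h : A → Bool) (xs ys : List A) → xorSum h (xs ++ ys) ≡ xorSum h xs xor xorSum h ys
xorSum-++ h []       ys = refl
xorSum-++ h (x ∷ xs) ys = trans (cong (h x xor_) (xorSum-++ h xs ys)) (sym (xor-assoc (h x) _ _))

xorSum-map : (h : B → Bool) (f : A → B) (xs : List A) → xorSum h (List.map f xs) ≡ xorSum (h ∘ f) xs
xorSum-map h f []       = refl
xorSum-map h f (x ∷ xs) = cong (h (f x) xor_) (xorSum-map h f xs)

xorSum-allVecs : (h : F2^ n → Bool) → xorSum h (allVecs n) ≡ ∑ⱽ h
xorSum-allVecs {zero}  h = xor-identityʳ (h [])
xorSum-allVecs {suc n} h = begin
  xorSum h (List.map (false ∷_) (allVecs n) ++ List.map (true ∷_) (allVecs n))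
    ≡⟨ xorSum-++ h (List.map (false ∷_) (allVecs n)) _ ⟩
  xorSum h (List.map (false ∷_) (allVecs n)) xor xorSum h (List.map (true ∷_) (allVecs n))
    ≡⟨ cong₂ _xor_ (xorSum-map h (false ∷_) (allVecs n)) (xorSum-map h (true ∷_) (allVecs n)) ⟩
  xorSum (h ∘ (false ∷_)) (allVecs n) xor xorSum (h ∘ (true ∷_)) (allVecs n)
    ≡⟨ cong₂ _xor_ (xorSum-allVecs (h ∘ (false ∷_))) (xorSum-allVecs (h ∘ (true ∷_))) ⟩
  ∑ⱽ h ∎

sumOver-coordinates : (V : VSet n) (F : VecFn n m) →
  sumOver V (evalVec F) ≡ map (λ f → ∑∈ V (evalFn f)) F
sumOver-coordinates {n} V F =
  trans (on-list (allVecs n)) (map-cong (λ f → xorSum-allVecs (λ x → V x ∧ evalFn f x)) F)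
  where
  map-⊕ : ∀ {m} (g h : BoolFn n → Bool) (F : VecFn n m) →
          map g F ⊕ map h F ≡ map (λ f → g f xor h f) F
  map-⊕ g h []      = refl
  map-⊕ g h (f ∷ F) = cong ((g f xor h f) ∷_) (map-⊕ g h F)
  on-list : (xs : List (F2^ n)) →
    List.foldr (λ x acc → (if V x then evalVec F x else zeroV) ⊕ acc) zeroV xs
      ≡ map (λ f → xorSum (λ x → V x ∧ evalFn f x) xs) F
  on-list []       = sym (map-const F false)
  on-list (x ∷ xs) with V x | on-list xs
  ... | true  | ih = trans (cong (evalVec F x ⊕_) ih) (map-⊕ (λ f → evalFn f x) _ F)
  ... | false | ih = trans (⊕-identityˡ _) ih

functionSum-dual : (R : Presentation n k l) (f : BoolFn n) → HomogeneousFn k f →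
  ∑∈ ⟦ R ⟧ (evalFn f) ≡ ∑∈ ⟦ dual R ⟧ (evalFn (complFn f))
functionSum-dual R []      []          = trans (∑∈-zero ⟦ R ⟧) (sym (∑∈-zero ⟦ dual R ⟧))
functionSum-dual R (I ∷ f) (∣I∣ ∷ hom) = begin
  ∑∈ ⟦ R ⟧ (evalFn (I ∷ f))
    ≡⟨ ∑∈-xor ⟦ R ⟧ (evalMon I) (evalFn f) ⟩
  ∑∈ ⟦ R ⟧ (evalMon I) xor ∑∈ ⟦ R ⟧ (evalFn f)
    ≡⟨ cong₂ _xor_ (monomialSum-dual R I ∣I∣) (functionSum-dual R f hom) ⟩
  ∑∈ ⟦ dual R ⟧ (evalMon (complMon I)) xor ∑∈ ⟦ dual R ⟧ (evalFn (complFn f))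
    ≡⟨ ∑∈-xor ⟦ dual R ⟧ (evalMon (complMon I)) (evalFn (complFn f)) ⟨
  ∑∈ ⟦ dual R ⟧ (evalFn (complFn (I ∷ f)))
    ∎

sumOver-dual : (U : VSet n) (R : Presentation n k l) → U ≗ ⟦ R ⟧ → (F : VecFn n m) → Homogeneous k F →
  sumOver U (evalVec F) ≡ sumOver (perp U) (evalVec (complVec F))
sumOver-dual {n} {k} U R U≗R F hom = begin
  sumOver U (evalVec F)                               ≡⟨ sumOver-coordinates U F ⟩
  map (λ f → ∑∈ U (evalFn f)) F                       ≡⟨ coordinates F hom ⟩
  map (λ f → ∑∈ (perp U) (evalFn f)) (complVec F)     ≡⟨ sumOver-coordinates (perp U) (complVec F) ⟨
  sumOver (perp U) (evalVec (complVec F))             ∎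
  where
  coordinate : (f : BoolFn n) → HomogeneousFn k f → ∑∈ U (evalFn f) ≡ ∑∈ (perp U) (evalFn (complFn f))
  coordinate f hom = begin
    ∑∈ U (evalFn f)                              ≡⟨ ∑∈-cong-set (evalFn f) U≗R ⟩
    ∑∈ ⟦ R ⟧ (evalFn f)                          ≡⟨ functionSum-dual R f hom ⟩
    ∑∈ ⟦ dual R ⟧ (evalFn (complFn f))           ≡⟨ ∑∈-cong-set (evalFn (complFn f)) (perp-dual U R U≗R) ⟨
    ∑∈ (perp U) (evalFn (complFn f))             ∎
  coordinates : ∀ {m} (F : VecFn n m) → Homogeneous k F →
    map (λ f → ∑∈ U (evalFn f)) F ≡ map (λ f → ∑∈ (perp U) (evalFn f)) (complVec F)
  coordinates []      _          = refl
  coordinates (f ∷ F) (hf , hF) = cong₂ _∷_ (coordinate f hf) (coordinates F hF)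

corollary5p14 : (n m k : ℕ) (F : VecFn n m) → IsANFVec F → Homogeneous k F →
    (U : VSet n) → IsSubspaceDim k U →
    InN k F U ⇔ InN (n ∸ k) (complVec F) (perp U)
corollary5p14 n m k F _ hom U dimU with presentation U dimU
... | l , R , U≗R = mk⇔
  (λ (_ , ≢0) → dimPerp , ≢0 ∘ trans sums)
  (λ (_ , ≢0) → dimU , ≢0 ∘ trans (sym sums))
  where
  sums : sumOver U (evalVec F) ≡ sumOver (perp U) (evalVec (complVec F))
  sums = sumOver-dual U R U≗R F hom
  dimPerp : IsSubspaceDim (n ∸ k) (perp U)
  dimPerp = subst (λ j → IsSubspaceDim j (perp U))
                  (trans (sym (m+n∸m≡n k l)) (cong (_∸ k) (dimension-sum R)))
                  (perp-subspaceDim U R U≗R)
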